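{- Let $0<\alpha\le\frac1{14}$ and $0<\varepsilon\le\frac1{21}\alpha$. Suppose that the graph $H_7$ is a subgraph of a finite graph $G$ such that every vertex $s\in V(H_7)$ satisfies $\deg_G(s)=3$. Then $H_7$ is a $(3,\varepsilon,\alpha)$-reducible subgraph of $G$.
   Context: $H_7$ is the graph with vertex set $\{a,b,v,w,x,y,z\}$ and edge set $\{ab,aw,bw,av,bv,vz,wy,xy,xz,yz\}$: two triangles $abw$ and $xyz$ joined by the edge $wy$, together with a vertex $v$ adjacent to $a$, $b$ and $z$. (All vertices have degree $3$ in $H_7$ except $x$, which has degree $2$.) A $3$-assignment $L$ on $G$ maps each vertex to a set of $3$ colors; an $L$-coloring is a proper coloring with $\phi(u)\in L(u)$. For $0<\varepsilon\le\alpha$, a distribution on $L$-colorings $\phi$ of $G$ is a $(3,\varepsilon,\alpha)$-distribution if $\Pr(\phi(u)=c)\ge\varepsilon$ for all $u$, $c\in L(u)$, and $\Pr(\phi(u)\ne c)\ge\alpha$ for every vertex $u$ and color $c$. An induced subgraph $H$ of $G$ is a $(3,\varepsilon,\alpha)$-reducible subgraph of $G$ if there is a nonempty $S\subseteq V(H)$ such that for every $3$-assignment $L$ on $G$, the existence of a $(3,\varepsilon,\alpha)$-distribution on $L$-colorings of $G\setminus S$ implies the existence of a $(3,\varepsilon,\alpha)$-distribution on $L$-colorings of $G$.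
   Formalization: The parameters α and ε range over ℚ, and the distributions on L-colorings are taken with finitely supported rational weights. -}

module Defs where

open import Data.Nat as ℕ using (ℕ; zero; suc)
open import Data.Fin using (Fin; zero; suc)
open import Data.Fin.Subset using (Subset; _∈_; _∉_; ∁; Nonempty)
open import Data.Bool using (Bool; true; false; if_then_else_)
open import Data.List using (List; []; _∷_; map; allFin)
open import Data.Nat.ListAction using (sum)
open import Data.Vec using (Vec; lookup)
import Data.Vec.Membership.Propositional as VecM
open import Data.Product using (Σ; ∃; _×_; _,_)
open import Data.Integer using (+_)
open import Data.Rational using (ℚ; 0ℚ; 1ℚ; _+_; _*_; _≤_; _<_; _/_)
open import Relation.Nullary using (¬_; yes; no)
open import Relation.Binary.PropositionalEquality using (_≡_; _≢_)

record Graph : Set where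
  field
    n     : ℕ
    adj   : Fin n → Fin n → Bool
    sym   : ∀ u v → adj u v ≡ adj v u
    irrefl : ∀ v → adj v v ≡ false
open Graph public

deg : (G : Graph) → Fin (n G) → ℕ
deg G v = sum (map (λ u → if adj G v u then 1 else 0) (allFin (n G)))

H7-edges : List (Fin 7 × Fin 7)
H7-edges =
  (a , b) ∷ (a , w) ∷ (b , w) ∷ (a , v) ∷ (b , v) ∷
  (v , z) ∷ (w , y) ∷ (x , y) ∷ (x , z) ∷ (y , z) ∷ []
  where
  a b v w x y z : Fin 7
  a = zero
  b = suc zero
  v = suc (suc zero)
  w = suc (suc (suc zero))
  x = suc (suc (suc (suc zero)))
  y = suc (suc (suc (suc (suc zero))))
  z = suc (suc (suc (suc (suc (suc zero)))))

data _∈ₗ_ {A : Set} (x : A) : List A → Set where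
  here  : ∀ {xs} → x ∈ₗ (x ∷ xs)
  there : ∀ {y xs} → x ∈ₗ xs → x ∈ₗ (y ∷ xs)

record H7-in (G : Graph) : Set where
  field
    emb      : Fin 7 → Fin (n G)
    emb-inj  : ∀ s t → emb s ≡ emb t → s ≡ t
    emb-edge : ∀ s t → (s , t) ∈ₗ H7-edges → adj G (emb s) (emb t) ≡ true
open H7-in public

record Assignment3 (G : Graph) : Set where
  field
    lists : Fin (n G) → Vec ℕ 3
    distinct : ∀ u i j → lookup (lists u) i ≡ lookup (lists u) j → i ≡ j
open Assignment3 public

_∈L_at_ : ∀ {G} → ℕ → Assignment3 G → Fin (n G) → Set
c ∈L L at u = VecM._∈_ c (lists L u)

-- An L-colouring of the induced subgraph G[W] (W a vertex subset):
-- a colour function whose values on W lie in the lists and which is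
-- proper on edges with both ends in W. (Values outside W are irrelevant.)
IsLColoring : (G : Graph) → Assignment3 G → Subset (n G) → (Fin (n G) → ℕ) → Set
IsLColoring G L W φ =
  (∀ u → u ∈ W → φ u ∈L L at u) ×
  (∀ u v → u ∈ W → v ∈ W → adj G u v ≡ true → φ u ≢ φ v)

Dist : ℕ → Set
Dist m = List (ℚ × (Fin m → ℕ))

total : ∀ {m} → Dist m → ℚ
total [] = 0ℚ
total ((p , _) ∷ d) = p + total d

PrEq : ∀ {m} → Dist m → Fin m → ℕ → ℚ
PrEq [] u c = 0ℚ
PrEq ((p , φ) ∷ d) u c with φ u ℕ.≟ c
... | yes _ = p + PrEq d u c
... | no  _ = PrEq d u c

PrNeq : ∀ {m} → Dist m → Fin m → ℕ → ℚ
PrNeq [] u c = 0ℚ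
PrNeq ((p , φ) ∷ d) u c with φ u ℕ.≟ c
... | yes _ = PrNeq d u c
... | no  _ = p + PrNeq d u c

data AllD {m} (P : ℚ → (Fin m → ℕ) → Set) : Dist m → Set where
  []  : AllD P []
  _∷_ : ∀ {p φ d} → P p φ → AllD P d → AllD P ((p , φ) ∷ d)

IsDistOnLColorings : (G : Graph) → Assignment3 G → Subset (n G) → Dist (n G) → Set
IsDistOnLColorings G L W d =
  AllD (λ p φ → (0ℚ ≤ p) × IsLColoring G L W φ) d × (total d ≡ 1ℚ)

Is3Dist : (G : Graph) → Assignment3 G → Subset (n G) → ℚ → ℚ → Dist (n G) → Set
Is3Dist G L W ε α d =
  IsDistOnLColorings G L W d ×
  (∀ u c → u ∈ W → c ∈L L at u → ε ≤ PrEq d u c) ×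
  (∀ u c → u ∈ W → α ≤ PrNeq d u c)

Has3Dist : (G : Graph) → Assignment3 G → Subset (n G) → ℚ → ℚ → Set
Has3Dist G L W ε α = ∃ λ d → Is3Dist G L W ε α d

full : ∀ {m} → Subset m
full = Data.Vec.replicate _ true

Reducible3 : (G : Graph) → H7-in G → ℚ → ℚ → Set
Reducible3 G H ε α =
  Σ (Subset (n G)) λ S →
    Nonempty S ×
    (∀ v → v ∈ S → ∃ λ s → emb H s ≡ v) ×
    (∀ (L : Assignment3 G) → Has3Dist G L (∁ S) ε α → Has3Dist G L full ε α)

1/14 1/21 : ℚ
1/14 = + 1 / 14
1/21 = + 1 / 21

module Submission where

-- Take S = V(H₇). In G each vertex of H₇ has all three neighbours in H₇, except 𝐱, whose third
-- neighbour x′ lies outside; so a colouring ψ of G ∖ S extends by any L-colouring of H₇ avoiding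
-- ψ(x′) at 𝐱. Replace ψ by the uniform mixture of 42 such extensions, six for each vertex s: every
-- colour of L(s) that some extension gives to s appears in two of the six, and every colour is
-- avoided in at least three. Hence Pr(φ(s) ≠ c) ≥ 3/42 = 1/14 ≥ α. A colour c ∈ L(s) is given to s
-- by no extension only when ψ(x′) is one particular colour f₀(s, c): c itself when s = 𝐱, and when
-- s = 𝐯 the unique x ∈ L(𝐱) such that c and x together exclude at most one colour of L(𝐳) (dually
-- for 𝐰). So Pr(φ(s) = c) ≥ (2/42) · Pr(ψ(x′) ≠ f₀) ≥ α/21 ≥ ε, and outside S nothing changes.
-- An extension is a colouring of the triangle 𝐱𝐲𝐳 and one of the diamond 𝐚𝐛𝐯𝐰, which interact
-- only through the edges 𝐯𝐳 and 𝐰𝐲; all counting is pigeonhole on palettes of three colours.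

open import Defs renaming (sym to adj-sym)

open import Algebra.Bundles using (Ring)
open import Data.Bool as Bool using (Bool; true; false; if_then_else_; not)
open import Data.Bool.Properties using (if-cong; if-float)
open import Data.Empty using (⊥; ⊥-elim)
open import Data.Fin as Fin using (Fin; zero; suc; punchIn; punchOut)
open import Data.Fin.Properties
  using (injective⇒≤; all?; any?; suc-injective; punchInᵢ≢i; punchIn-punchOut; punchIn-injective)
open import Data.Fin.Subset using (Subset; ∁) renaming (_∈_ to _∈ₛ_)
open import Data.Fin.Subset.Properties using (x∉p⇒x∈∁p)
import Data.Integer as ℤ
open import Data.List as List using (List; []; _∷_; _++_; length; filter; allFin)
open import Data.List.Membership.DecPropositional using () renaming (_∈?_ to _∈?ˡ_)
open import Data.List.Membership.Propositional using ()
  renaming (_∈_ to _∈ˡ_; _∉_ to _∉ˡ_; find to findˡ)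
open import Data.List.Membership.Propositional.Properties
  using (∈-lookup; ∈-filter⁺; ∈-filter⁻; ∈-allFin; ∈-tabulate⁺; ∈-map⁺; ∈-map⁻)
open import Data.List.Properties using (length-++; length-map)
open import Data.List.Relation.Binary.Subset.Propositional using (_⊆_)
open import Data.List.Relation.Unary.All as All using (All; []; _∷_)
import Data.List.Relation.Unary.All.Properties as All
open import Data.List.Relation.Unary.AllPairs using ([]; _∷_)
open import Data.List.Relation.Unary.Any as Any using (here; there)
open import Data.List.Relation.Unary.Any.Properties using (lookup-index)
open import Data.List.Relation.Unary.Unique.Propositional using (Unique)
import Data.List.Relation.Unary.Unique.Propositional.Properties as Unique
open import Data.Nat as ℕ using (ℕ; zero; suc; z≤n; s≤s)
open import Data.Nat.ListAction using (sum)
import Data.Nat.Properties as ℕ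
open import Data.Product as Product using (Σ; ∃; ∃₂; _×_; _,_; proj₁; proj₂)
open import Data.Product.Properties using (≡-dec)
open import Data.Rational using (ℚ; 0ℚ; 1ℚ; _+_; _*_; _/_; _≤_; _<_; nonNegative)
open import Data.Rational.Properties as ℚ using (+-*-ring)
open import Algebra.Properties.Semiring.Mult (Ring.semiring +-*-ring) using () renaming (_×_ to _·_)
open import Data.Sum as Sum using (_⊎_; inj₁; inj₂)
open import Data.Vec as Vec using (Vec; toList; lookup)
open import Data.Vec.Membership.DecPropositional ℕ._≟_ using (_∈?_)
open import Data.Vec.Membership.Propositional using (_∈_; _∉_; find; lose)
open import Data.Vec.Membership.Propositional.Properties using (∈-toList⁺; ∈-toList⁻)
  renaming (∈-lookup to lookup-∈)
open import Data.Vec.Properties using (length-toList; lookup∘tabulate; lookup⇒[]=; []=⇒lookup)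
import Data.Vec.Relation.Unary.Any as VecAny
import Data.Vec.Relation.Unary.Any.Properties as VecAny
open import Function using (_∘_)
open import Function.Definitions using (Injective)
open import Relation.Binary.Definitions using (DecidableEquality)
open import Relation.Binary.PropositionalEquality
open import Relation.Nullary using (¬_; Dec; yes; no; does; contradiction)
open import Relation.Nullary.Decidable
  using (¬?; _⊎-dec_; _×-dec_; _→-dec_; from-yes; decidable-stable; dec-true; dec-false)

-- Pigeonhole for duplicate-free lists

module _ {A : Set} where

  unique⇒lookup-injective : ∀ {xs : List A} → Unique xs →
    ∀ {i j} → List.lookup xs i ≡ List.lookup xs j → i ≡ j
  unique⇒lookup-injective (_ ∷ _) {zero} {zero} _ = refl
  unique⇒lookup-injective (x∉xs ∷ _) {zero} {suc j} eq = contradiction eq (All.lookup x∉xs (∈-lookup j))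
  unique⇒lookup-injective (x∉xs ∷ _) {suc i} {zero} eq = contradiction (sym eq) (All.lookup x∉xs (∈-lookup i))
  unique⇒lookup-injective (_ ∷ xs!) {suc i} {suc j} eq = cong suc (unique⇒lookup-injective xs! eq)

  unique⊆⇒length≤ : ∀ {xs ys : List A} → Unique xs → xs ⊆ ys → length xs ℕ.≤ length ys
  unique⊆⇒length≤ {xs} {ys} xs! xs⊆ys = injective⇒≤ position-injective
    where
    position : Fin (length xs) → Fin (length ys)
    position i = Any.index (xs⊆ys (∈-lookup i))

    lookup-position : ∀ i → List.lookup xs i ≡ List.lookup ys (position i)
    lookup-position i = lookup-index (xs⊆ys (∈-lookup i))

    position-injective : Injective _≡_ _≡_ position
    position-injective {i} {j} eq = unique⇒lookup-injective xs!
      (trans (lookup-position i) (trans (cong (List.lookup ys) eq) (sym (lookup-position j))))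

  length<⇒∃∉ : DecidableEquality A → ∀ {xs ys : List A} → Unique xs → length ys ℕ.< length xs →
    ∃ λ x → x ∈ˡ xs × x ∉ˡ ys
  length<⇒∃∉ _≟_ {xs} {ys} xs! ys<xs with Any.any? (λ x → ¬? (_∈?ˡ_ _≟_ x ys)) xs
  ... | yes x∉ys = findˡ x∉ys
  ... | no ¬x∉ys = contradiction (unique⊆⇒length≤ xs! xs⊆ys) (ℕ.<⇒≱ ys<xs)
    where
    xs⊆ys : xs ⊆ ys
    xs⊆ys x∈xs = decidable-stable (_∈?ˡ_ _≟_ _ ys) λ x∉ys → ¬x∉ys (Any.map (λ { refl → x∉ys }) x∈xs)

  Distinct : ∀ {n} → Vec A n → Set
  Distinct xs = ∀ i j → lookup xs i ≡ lookup xs j → i ≡ j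

  distinct⇒unique : ∀ {n} {xs : Vec A n} → Distinct xs → Unique (toList xs)
  distinct⇒unique {xs = Vec.[]} _ = []
  distinct⇒unique {xs = x Vec.∷ xs} xs! =
    All.tabulate head-fresh ∷ distinct⇒unique (λ i j eq → suc-injective (xs! (suc i) (suc j) eq))
    where
    head-fresh : ∀ {y} → y ∈ˡ toList xs → x ≢ y
    head-fresh {y} y∈xs x≡y =
      contradiction (xs! zero (suc (VecAny.index y∈)) (trans x≡y (VecAny.lookup-index y∈))) λ ()
      where
      y∈ : y ∈ xs
      y∈ = ∈-toList⁻ y∈xs

-- Palettes of three distinct colours

-- Existence proofs are opaque: only their statements matter, and unfolding them into the
-- colourings built from them makes type checking blow up.
opaque
  avoid₂ : ∀ {l : Vec ℕ 3} → Distinct l → ∀ p q → ∃ λ c → c ∈ l × c ≢ p × c ≢ q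
  avoid₂ {l} l! p q
    with c , c∈l , c∉pq ← length<⇒∃∉ ℕ._≟_ {ys = p ∷ q ∷ []} (distinct⇒unique l!)
                                      (subst (2 ℕ.<_) (sym (length-toList l)) ℕ.≤-refl)
    = c , ∈-toList⁻ c∈l , (λ c≡p → c∉pq (here c≡p)) , (λ c≡q → c∉pq (there (here c≡q)))

  two-avoiding : ∀ {l : Vec ℕ 3} → Distinct l → ∀ p →
    ∃₂ λ c₁ c₂ → c₁ ∈ l × c₂ ∈ l × c₁ ≢ c₂ × c₁ ≢ p × c₂ ≢ p
  two-avoiding l! p
    with c₁ , c₁∈l , c₁≢p , _ ← avoid₂ l! p p
    with c₂ , c₂∈l , c₂≢p , c₂≢c₁ ← avoid₂ l! p c₁
    = c₁ , c₂ , c₁∈l , c₂∈l , ≢-sym c₂≢c₁ , c₁≢p , c₂≢p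

no-four-distinct : ∀ {l : Vec ℕ 3} {c₁ c₂ c₃ c₄} → c₁ ∈ l → c₂ ∈ l → c₃ ∈ l → c₄ ∈ l →
  c₁ ≢ c₂ → c₁ ≢ c₃ → c₁ ≢ c₄ → c₂ ≢ c₃ → c₂ ≢ c₄ → c₃ ≢ c₄ → ⊥
no-four-distinct {l} c₁∈ c₂∈ c₃∈ c₄∈ c₁≢c₂ c₁≢c₃ c₁≢c₄ c₂≢c₃ c₂≢c₄ c₃≢c₄ =
  ℕ.<-irrefl refl (subst (4 ℕ.≤_) (length-toList l) (unique⊆⇒length≤ cs! ⊆l))
  where
  cs! : Unique (_ ∷ _ ∷ _ ∷ _ ∷ [])
  cs! = (c₁≢c₂ ∷ c₁≢c₃ ∷ c₁≢c₄ ∷ []) ∷ (c₂≢c₃ ∷ c₂≢c₄ ∷ []) ∷ (c₃≢c₄ ∷ []) ∷ [] ∷ []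
  ⊆l : (_ ∷ _ ∷ _ ∷ _ ∷ []) ⊆ toList l
  ⊆l = ∈-toList⁺ ∘ All.lookup (c₁∈ ∷ c₂∈ ∷ c₃∈ ∷ c₄∈ ∷ [])

AtMostOneIn : ∀ {n} → Vec ℕ n → ℕ → ℕ → Set
AtMostOneIn l p q = p ∉ l ⊎ q ∉ l ⊎ p ≡ q

atMostOneIn? : ∀ {n} (l : Vec ℕ n) p q → Dec (AtMostOneIn l p q)
atMostOneIn? l p q = ¬? (p ∈? l) ⊎-dec ¬? (q ∈? l) ⊎-dec p ℕ.≟ q

¬atMostOneIn : ∀ {n} {l : Vec ℕ n} {p q} → ¬ AtMostOneIn l p q → p ∈ l × q ∈ l × p ≢ q
¬atMostOneIn {l = l} {p} {q} ¬one =
  decidable-stable (p ∈? l) (¬one ∘ inj₁) ,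
  decidable-stable (q ∈? l) (¬one ∘ inj₂ ∘ inj₁) ,
  ¬one ∘ inj₂ ∘ inj₂

opaque
  avoid₃ : ∀ {l : Vec ℕ 3} → Distinct l → ∀ {p q} → AtMostOneIn l p q →
    ∀ r → ∃ λ c → c ∈ l × c ≢ p × c ≢ q × c ≢ r
  avoid₃ l! {p} {q} (inj₁ p∉l) r with c , c∈l , c≢q , c≢r ← avoid₂ l! q r =
    c , c∈l , (λ { refl → p∉l c∈l }) , c≢q , c≢r
  avoid₃ l! {p} {q} (inj₂ (inj₁ q∉l)) r with c , c∈l , c≢p , c≢r ← avoid₂ l! p r =
    c , c∈l , c≢p , (λ { refl → q∉l c∈l }) , c≢r
  avoid₃ l! {p} (inj₂ (inj₂ refl)) r with c , c∈l , c≢p , c≢r ← avoid₂ l! p r =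
    c , c∈l , c≢p , c≢p , c≢r

  ∃-atMostOneIn : ∀ {l m : Vec ℕ 3} → Distinct l → Distinct m → ∀ c → ∃ λ w → w ∈ m × AtMostOneIn l c w
  ∃-atMostOneIn {l} l! m! c
    with a₁ , a₂ , a₁∈ , a₂∈ , a₁≢a₂ , a₁≢c , a₂≢c ← two-avoiding l! c
    with w , w∈ , w≢a₁ , w≢a₂ ← avoid₂ m! a₁ a₂
    with atMostOneIn? l c w
  ... | yes one = w , w∈ , one
  ... | no ¬one with c∈ , w∈l , c≢w ← ¬atMostOneIn ¬one =
    ⊥-elim (no-four-distinct c∈ a₁∈ a₂∈ w∈l (≢-sym a₁≢c) (≢-sym a₂≢c) c≢w a₁≢a₂ (≢-sym w≢a₁) (≢-sym w≢a₂))

-- With l, m the palettes of 𝐱 and 𝐳, this is the only way the colour c at 𝐯 can fail to extend: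
-- whichever colour x ≠ f the vertex 𝐱 takes, c and x use up two of the three colours of 𝐳.
Blocked : Vec ℕ 3 → ℕ → Vec ℕ 3 → ℕ → Set
Blocked l f m c = ∀ x → x ∈ l → x ≢ f → ¬ AtMostOneIn m c x

opaque
  blocked? : ∀ l f m c → ∃ (λ x → x ∈ l × x ≢ f × AtMostOneIn m c x) ⊎ Blocked l f m c
  blocked? l f m c with VecAny.any? (λ x → ¬? (x ℕ.≟ f) ×-dec atMostOneIn? m c x) l
  ... | yes found with x , x∈l , x≢f , one ← find found = inj₁ (x , x∈l , x≢f , one)
  ... | no none = inj₂ λ x x∈l x≢f one → none (lose x∈l (x≢f , one))

module _ {l : Vec ℕ 3} (l! : Distinct l) {m : Vec ℕ 3} where

  blocked-unique : ∀ {f c c′} → Blocked l f m c → Blocked l f m c′ → c ≡ c′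
  blocked-unique {f} {c} {c′} c-blocked c′-blocked with c ℕ.≟ c′
  ... | yes c≡c′ = c≡c′
  ... | no c≢c′
    with x₁ , x₂ , x₁∈ , x₂∈ , x₁≢x₂ , x₁≢f , x₂≢f ← two-avoiding l! f
    with c∈ , x₁∈m , c≢x₁ ← ¬atMostOneIn (c-blocked x₁ x₁∈ x₁≢f)
    with _ , x₂∈m , c≢x₂ ← ¬atMostOneIn (c-blocked x₂ x₂∈ x₂≢f)
    with c′∈ , _ , c′≢x₁ ← ¬atMostOneIn (c′-blocked x₁ x₁∈ x₁≢f)
    with _ , _ , c′≢x₂ ← ¬atMostOneIn (c′-blocked x₂ x₂∈ x₂≢f)
    = ⊥-elim (no-four-distinct c∈ c′∈ x₁∈m x₂∈m c≢c′ c≢x₁ c≢x₂ c′≢x₁ c′≢x₂ x₁≢x₂)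

  opaque
    blocked-forced : ∀ c → ∃ λ f₀ → ∀ f → Blocked l f m c → f ≡ f₀
    blocked-forced c with VecAny.any? (atMostOneIn? m c) l
    ... | yes found with x , x∈l , one ← find found = x , forced
      where
      forced : ∀ f → Blocked l f m c → f ≡ x
      forced f c-blocked with x ℕ.≟ f
      ... | yes x≡f = sym x≡f
      ... | no  x≢f = ⊥-elim (c-blocked x x∈l x≢f one)
    -- otherwise c and the three colours of l would be four distinct colours of m
    ... | no none
      with x₁ , x₂ , x₁∈ , x₂∈ , x₁≢x₂ , _ ← two-avoiding l! 0
      with x₃ , x₃∈ , x₃≢x₁ , x₃≢x₂ ← avoid₂ l! x₁ x₂
      with c∈ , x₁∈m , c≢x₁ ← ¬atMostOneIn (none ∘ lose x₁∈)
      with _ , x₂∈m , c≢x₂ ← ¬atMostOneIn (none ∘ lose x₂∈)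
      with _ , x₃∈m , c≢x₃ ← ¬atMostOneIn (none ∘ lose x₃∈)
      = ⊥-elim (no-four-distinct c∈ x₁∈m x₂∈m x₃∈m c≢x₁ c≢x₂ c≢x₃ x₁≢x₂ (≢-sym x₃≢x₁) (≢-sym x₃≢x₂))

-- Counting and finite distributions

count : ∀ {A : Set} → (A → Bool) → List A → ℕ
count E [] = 0
count E (x ∷ xs) = if E x then suc (count E xs) else count E xs

count-const : ∀ {A : Set} b (xs : List A) → count (λ _ → b) xs ≡ (if b then length xs else 0)
count-const true  []       = refl
count-const true  (x ∷ xs) = cong suc (count-const true xs)
count-const false []       = refl
count-const false (x ∷ xs) = count-const false xs

module _ {A : Set} (E : A → Bool) where

  count-++ : ∀ xs ys → count E (xs ++ ys) ≡ count E xs ℕ.+ count E ys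
  count-++ [] ys = refl
  count-++ (x ∷ xs) ys with E x
  ... | true  = cong suc (count-++ xs ys)
  ... | false = count-++ xs ys

  count-map : ∀ {B : Set} (g : B → A) xs → count E (List.map g xs) ≡ count (E ∘ g) xs
  count-map g [] = refl
  count-map g (x ∷ xs) with E (g x)
  ... | true  = cong suc (count-map g xs)
  ... | false = count-map g xs

  count-cong : ∀ {E′ : A → Bool} → (∀ x → E x ≡ E′ x) → ∀ xs → count E xs ≡ count E′ xs
  count-cong E≗E′ [] = refl
  count-cong {E′} E≗E′ (x ∷ xs) with E x | E′ x | E≗E′ x
  ... | true  | _ | refl = cong suc (count-cong E≗E′ xs)
  ... | false | _ | refl = count-cong E≗E′ xs

  count-concat-≥ : ∀ {xs xss} → xs ∈ˡ xss → count E xs ℕ.≤ count E (List.concat xss)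
  count-concat-≥ {xs} {xs ∷ xss} (here refl) =
    subst (count E xs ℕ.≤_) (sym (count-++ xs (List.concat xss))) (ℕ.m≤m+n _ _)
  count-concat-≥ {xss = ys ∷ xss} (there xs∈xss) =
    subst (_ ℕ.≤_) (sym (count-++ ys (List.concat xss))) (ℕ.≤-trans (count-concat-≥ xs∈xss) (ℕ.m≤n+m _ _))

  count-≥2 : ∀ x → E x ≡ true → ∀ xs ys → 2 ℕ.≤ count E (xs ++ x ∷ x ∷ ys)
  count-≥2 x Ex xs ys rewrite count-++ xs (x ∷ x ∷ ys) | Ex =
    ℕ.≤-trans (s≤s (s≤s z≤n)) (ℕ.m≤n+m _ (count E xs))

  count-pairs-≥3 : ∀ x y z → (E x ≡ false → E y ≡ false → ⊥) → (E x ≡ false → E z ≡ false → ⊥) →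
    (E y ≡ false → E z ≡ false → ⊥) → 3 ℕ.≤ count E (x ∷ x ∷ y ∷ y ∷ z ∷ z ∷ [])
  count-pairs-≥3 x y z xy xz yz with E x | E y | E z
  ... | false | false | _     = ⊥-elim (xy refl refl)
  ... | false | _     | false = ⊥-elim (xz refl refl)
  ... | _     | false | false = ⊥-elim (yz refl refl)
  ... | true  | true  | true  = ℕ.m≤m+n 3 3
  ... | true  | true  | false = ℕ.m≤m+n 3 1
  ... | true  | false | true  = ℕ.m≤m+n 3 1
  ... | false | true  | true  = ℕ.m≤m+n 3 1

  count-triples-≥3 : ∀ x y → (E x ≡ false → E y ≡ false → ⊥) → 3 ℕ.≤ count E (x ∷ x ∷ x ∷ y ∷ y ∷ y ∷ [])
  count-triples-≥3 x y xy with E x | E y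
  ... | false | false = ⊥-elim (xy refl refl)
  ... | true  | true  = ℕ.m≤m+n 3 3
  ... | true  | false = ℕ.≤-refl
  ... | false | true  = ℕ.≤-refl

length-concat-tabulate : ∀ {A : Set} {k} n (g : Fin n → List A) → (∀ i → length (g i) ≡ k) →
  length (List.concat (List.tabulate g)) ≡ n ℕ.* k
length-concat-tabulate zero g _ = refl
length-concat-tabulate (suc n) g length-g = begin
  length (g zero ++ List.concat (List.tabulate (g ∘ suc)))
    ≡⟨ length-++ (g zero) ⟩
  length (g zero) ℕ.+ length (List.concat (List.tabulate (g ∘ suc)))
    ≡⟨ cong₂ ℕ._+_ (length-g zero) (length-concat-tabulate n (g ∘ suc) (length-g ∘ suc)) ⟩
  _ ∎
  where open ≡-Reasoning

all⊎∃ : ∀ {n} {R B : Fin n → Set} → (∀ i → R i ⊎ B i) → (∀ i → R i) ⊎ ∃ B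
all⊎∃ {zero} r⊎b = inj₁ λ ()
all⊎∃ {suc n} r⊎b with r⊎b zero | all⊎∃ (r⊎b ∘ suc)
... | inj₂ b₀ | _             = inj₂ (zero , b₀)
... | inj₁ _  | inj₂ (i , bᵢ) = inj₂ (suc i , bᵢ)
... | inj₁ r₀ | inj₁ rs       = inj₁ λ { zero → r₀ ; (suc i) → rs i }

·-nonneg : ∀ {w} → 0ℚ ≤ w → ∀ n → 0ℚ ≤ n · w
·-nonneg w≥0 zero = ℚ.≤-refl
·-nonneg {w} w≥0 (suc n) = subst (_≤ w + n · w) (ℚ.+-identityʳ 0ℚ) (ℚ.+-mono-≤ w≥0 (·-nonneg w≥0 n))

·-monoˡ-≤ : ∀ {w} → 0ℚ ≤ w → ∀ {m n} → m ℕ.≤ n → m · w ≤ n · w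
·-monoˡ-≤ w≥0 {n = n} z≤n = ·-nonneg w≥0 n
·-monoˡ-≤ {w} w≥0 (s≤s m≤n) = ℚ.+-monoʳ-≤ w (·-monoˡ-≤ w≥0 m≤n)

Event : ℕ → Set
Event k = (Fin k → ℕ) → Bool

coloured : ∀ {k} → Fin k → ℕ → Event k
coloured u c φ = does (φ u ℕ.≟ c)

module _ {k} {u : Fin k} {c : ℕ} (φ : Fin k → ℕ) where

  coloured⁺ : φ u ≡ c → coloured u c φ ≡ true
  coloured⁺ = dec-true (φ u ℕ.≟ c)

  not-coloured⇒≢ : not (coloured u c φ) ≡ true → φ u ≢ c
  not-coloured⇒≢ ¬φu≡c φu≡c = contradiction (trans (sym ¬φu≡c) (cong not (coloured⁺ φu≡c))) λ ()

  not-coloured⁻ : not (coloured u c φ) ≡ false → φ u ≡ c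
  not-coloured⁻ ¬φu≢c = decidable-stable (φ u ℕ.≟ c) λ φu≢c →
    contradiction (trans (sym ¬φu≢c) (cong not (dec-false (φ u ℕ.≟ c) φu≢c))) λ ()

Pr : ∀ {k} → Dist k → Event k → ℚ
Pr [] E = 0ℚ
Pr ((p , φ) ∷ d) E = if E φ then p + Pr d E else Pr d E

NonNegWeights : ∀ {k} → Dist k → Set
NonNegWeights = AllD (λ p _ → 0ℚ ≤ p)

scale : ∀ {k} → ℚ → Dist k → Dist k
scale p = List.map (Product.map₁ (p *_))

uniform : ∀ {k} → ℚ → List (Fin k → ℕ) → Dist k
uniform w = List.map (w ,_)

_>>=_ : ∀ {m k} → Dist m → ((Fin m → ℕ) → Dist k) → Dist k
[] >>= K = []
((p , ψ) ∷ d) >>= K = scale p (K ψ) ++ (d >>= K)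

module _ {k : ℕ} where

  PrEq≡Pr : ∀ (d : Dist k) u c → PrEq d u c ≡ Pr d (coloured u c)
  PrEq≡Pr [] u c = refl
  PrEq≡Pr ((p , φ) ∷ d) u c with φ u ℕ.≟ c
  ... | yes φu≡c = trans (cong (p +_) (PrEq≡Pr d u c)) (sym (if-cong (dec-true (φ u ℕ.≟ c) φu≡c)))
  ... | no  φu≢c = trans (PrEq≡Pr d u c) (sym (if-cong (dec-false (φ u ℕ.≟ c) φu≢c)))

  PrNeq≡Pr : ∀ (d : Dist k) u c → PrNeq d u c ≡ Pr d (not ∘ coloured u c)
  PrNeq≡Pr [] u c = refl
  PrNeq≡Pr ((p , φ) ∷ d) u c with φ u ℕ.≟ c
  ... | yes φu≡c = trans (PrNeq≡Pr d u c) (sym (if-cong (cong not (dec-true (φ u ℕ.≟ c) φu≡c))))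
  ... | no  φu≢c =
    trans (cong (p +_) (PrNeq≡Pr d u c)) (sym (if-cong (cong not (dec-false (φ u ℕ.≟ c) φu≢c))))

  total≡Pr : ∀ (d : Dist k) → total d ≡ Pr d (λ _ → true)
  total≡Pr [] = refl
  total≡Pr ((p , φ) ∷ d) = cong (p +_) (total≡Pr d)

  Pr-++ : ∀ (d e : Dist k) E → Pr (d ++ e) E ≡ Pr d E + Pr e E
  Pr-++ [] e E = sym (ℚ.+-identityˡ _)
  Pr-++ ((p , φ) ∷ d) e E with E φ
  ... | true  = trans (cong (p +_) (Pr-++ d e E)) (sym (ℚ.+-assoc p _ _))
  ... | false = Pr-++ d e E

  Pr-scale : ∀ p (d : Dist k) E → Pr (scale p d) E ≡ p * Pr d E
  Pr-scale p [] E = sym (ℚ.*-zeroʳ p)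
  Pr-scale p ((q , φ) ∷ d) E with E φ
  ... | true  = trans (cong (p * q +_) (Pr-scale p d E)) (sym (ℚ.*-distribˡ-+ p q _))
  ... | false = Pr-scale p d E

  Pr-uniform : ∀ w (l : List (Fin k → ℕ)) E → Pr (uniform w l) E ≡ count E l · w
  Pr-uniform w [] E = refl
  Pr-uniform w (φ ∷ l) E with E φ
  ... | true  = cong (w +_) (Pr-uniform w l E)
  ... | false = Pr-uniform w l E

  Pr-nonneg : ∀ {d : Dist k} → NonNegWeights d → ∀ E → 0ℚ ≤ Pr d E
  Pr-nonneg [] E = ℚ.≤-refl
  Pr-nonneg {(p , φ) ∷ d} (p≥0 ∷ d≥0) E with E φ
  ... | true  = subst (_≤ p + Pr d E) (ℚ.+-identityʳ 0ℚ) (ℚ.+-mono-≤ p≥0 (Pr-nonneg d≥0 E))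
  ... | false = Pr-nonneg d≥0 E

  module _ {Q : ℚ → (Fin k → ℕ) → Set} where

    AllD-++ : ∀ {d e : Dist k} → AllD Q d → AllD Q e → AllD Q (d ++ e)
    AllD-++ [] e = e
    AllD-++ (q ∷ d) e = q ∷ AllD-++ d e

    AllD-map : ∀ {Q′ : ℚ → (Fin k → ℕ) → Set} → (∀ {p φ} → Q p φ → Q′ p φ) → ∀ {d} → AllD Q d → AllD Q′ d
    AllD-map Q⇒Q′ [] = []
    AllD-map Q⇒Q′ (q ∷ d) = Q⇒Q′ q ∷ AllD-map Q⇒Q′ d

    AllD-uniform : ∀ w {φs} → All (Q w) φs → AllD Q (uniform w φs)
    AllD-uniform w [] = []
    AllD-uniform w (q ∷ φs) = q ∷ AllD-uniform w φs

    AllD-scale : ∀ p {d : Dist k} → AllD (λ q φ → Q (p * q) φ) d → AllD Q (scale p d)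
    AllD-scale p [] = []
    AllD-scale p (q ∷ d) = q ∷ AllD-scale p d

  module _ {m : ℕ} (K : (Fin m → ℕ) → Dist k) where

    AllD-bind : ∀ {P : ℚ → (Fin m → ℕ) → Set} {Q : ℚ → (Fin k → ℕ) → Set} →
      (∀ {p ψ} → P p ψ → AllD (λ q φ → Q (p * q) φ) (K ψ)) → ∀ {d} → AllD P d → AllD Q (d >>= K)
    AllD-bind K-Q [] = []
    AllD-bind K-Q {(p , ψ) ∷ d} (Pψ ∷ d-P) = AllD-++ (AllD-scale p (K-Q Pψ)) (AllD-bind K-Q d-P)

    Pr-bind : ∀ p ψ (d : Dist m) E → Pr (((p , ψ) ∷ d) >>= K) E ≡ p * Pr (K ψ) E + Pr (d >>= K) E
    Pr-bind p ψ d E =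
      trans (Pr-++ (scale p (K ψ)) (d >>= K) E) (cong (_+ Pr (d >>= K) E) (Pr-scale p (K ψ) E))

    Pr-bind-≡ : ∀ {E F} → (∀ ψ → Pr (K ψ) E ≡ (if F ψ then 1ℚ else 0ℚ)) → ∀ d → Pr (d >>= K) E ≡ Pr d F
    Pr-bind-≡ K-E [] = refl
    Pr-bind-≡ {E} {F} K-E ((p , ψ) ∷ d) with F ψ | K-E ψ
    ... | true  | K-E≡1 = begin
      Pr (((p , ψ) ∷ d) >>= K) E       ≡⟨ Pr-bind p ψ d E ⟩
      p * Pr (K ψ) E + Pr (d >>= K) E  ≡⟨ cong₂ (λ x y → p * x + y) K-E≡1 (Pr-bind-≡ K-E d) ⟩
      p * 1ℚ + Pr d F                  ≡⟨ cong (_+ Pr d F) (ℚ.*-identityʳ p) ⟩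
      p + Pr d F                       ∎
      where open ≡-Reasoning
    ... | false | K-E≡0 = begin
      Pr (((p , ψ) ∷ d) >>= K) E       ≡⟨ Pr-bind p ψ d E ⟩
      p * Pr (K ψ) E + Pr (d >>= K) E  ≡⟨ cong₂ (λ x y → p * x + y) K-E≡0 (Pr-bind-≡ K-E d) ⟩
      p * 0ℚ + Pr d F                  ≡⟨ cong (_+ Pr d F) (ℚ.*-zeroʳ p) ⟩
      0ℚ + Pr d F                      ≡⟨ ℚ.+-identityˡ (Pr d F) ⟩
      Pr d F                           ∎
      where open ≡-Reasoning

    Pr-bind-≥ : ∀ {E F β} → (∀ ψ → 0ℚ ≤ Pr (K ψ) E) → (∀ ψ → F ψ ≡ true → β ≤ Pr (K ψ) E) →
      ∀ {d} → NonNegWeights d → β * Pr d F ≤ Pr (d >>= K) E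
    Pr-bind-≥ {β = β} K-E≥0 K-E≥β {[]} [] = ℚ.≤-reflexive (ℚ.*-zeroʳ β)
    Pr-bind-≥ {E} {F} {β} K-E≥0 K-E≥β {(p , ψ) ∷ d} (p≥0 ∷ d≥0) with F ψ in Fψ
    ... | true = begin
      β * (p + Pr d F)                 ≡⟨ ℚ.*-distribˡ-+ β p (Pr d F) ⟩
      β * p + β * Pr d F               ≡⟨ cong (_+ β * Pr d F) (ℚ.*-comm β p) ⟩
      p * β + β * Pr d F               ≤⟨ ℚ.+-mono-≤ (ℚ.*-monoˡ-≤-nonNeg p {{nonNegative p≥0}} (K-E≥β ψ Fψ))
                                                     (Pr-bind-≥ K-E≥0 K-E≥β d≥0) ⟩
      p * Pr (K ψ) E + Pr (d >>= K) E  ≡⟨ Pr-bind p ψ d E ⟨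
      Pr (((p , ψ) ∷ d) >>= K) E       ∎
      where open ℚ.≤-Reasoning
    ... | false = begin
      β * Pr d F                       ≡⟨ ℚ.+-identityˡ (β * Pr d F) ⟨
      0ℚ + β * Pr d F                  ≤⟨ ℚ.+-mono-≤ weighted≥0 (Pr-bind-≥ K-E≥0 K-E≥β d≥0) ⟩
      p * Pr (K ψ) E + Pr (d >>= K) E  ≡⟨ Pr-bind p ψ d E ⟨
      Pr (((p , ψ) ∷ d) >>= K) E       ∎
      where
      open ℚ.≤-Reasoning
      weighted≥0 : 0ℚ ≤ p * Pr (K ψ) E
      weighted≥0 =
        subst (_≤ p * Pr (K ψ) E) (ℚ.*-zeroʳ p) (ℚ.*-monoˡ-≤-nonNeg p {{nonNegative p≥0}} (K-E≥0 ψ))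

-- Degrees

module _ (G : Graph) where

  neighbours : Fin (n G) → List (Fin (n G))
  neighbours v = filter (λ u → adj G v u Bool.≟ true) (allFin (n G))

  deg≡length-neighbours : ∀ v → deg G v ≡ length (neighbours v)
  deg≡length-neighbours v = indicator-sum (allFin (n G))
    where
    indicator-sum : ∀ us → sum (List.map (λ u → if adj G v u then 1 else 0) us)
                           ≡ length (filter (λ u → adj G v u Bool.≟ true) us)
    indicator-sum [] = refl
    indicator-sum (u ∷ us) with adj G v u
    ... | true  = cong suc (indicator-sum us)
    ... | false = indicator-sum us

  neighbours-unique : ∀ v → Unique (neighbours v)
  neighbours-unique v = Unique.filter⁺ _ (Unique.allFin⁺ (n G))

  ∈-neighbours : ∀ {v u} → adj G v u ≡ true → u ∈ˡ neighbours v
  ∈-neighbours {u = u} v~u = ∈-filter⁺ _ (∈-allFin u) v~u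

  neighbours-adjacent : ∀ {v u} → u ∈ˡ neighbours v → adj G v u ≡ true
  neighbours-adjacent {v} = proj₂ ∘ ∈-filter⁻ (λ u → adj G v u Bool.≟ true) {xs = allFin (n G)}

  adjacent-∈ : ∀ {v xs} → deg G v ≡ length xs → Unique xs → All (λ u → adj G v u ≡ true) xs →
    ∀ {u} → adj G v u ≡ true → u ∈ˡ xs
  adjacent-∈ {v} {xs} deg≡ xs! xs-adjacent {u} v~u with _∈?ˡ_ Fin._≟_ u xs
  ... | yes u∈xs = u∈xs
  ... | no  u∉xs = contradiction (unique⊆⇒length≤ (fresh ∷ xs!) ⊆neighbours)
                     (ℕ.≤⇒≯ (ℕ.≤-reflexive (trans (sym (deg≡length-neighbours v)) deg≡)))
    where
    fresh : All (u ≢_) xs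
    fresh = All.tabulate λ { y∈xs refl → u∉xs y∈xs }
    ⊆neighbours : (u ∷ xs) ⊆ neighbours v
    ⊆neighbours (here refl)  = ∈-neighbours v~u
    ⊆neighbours (there y∈xs) = ∈-neighbours (All.lookup xs-adjacent y∈xs)

  ∃-adjacent-∉ : ∀ {v xs} → length xs ℕ.< deg G v → ∃ λ u → adj G v u ≡ true × u ∉ˡ xs
  ∃-adjacent-∉ {v} xs<deg
    with u , u∈ , u∉xs ← length<⇒∃∉ Fin._≟_ (neighbours-unique v)
                                     (subst (_ ℕ.<_) (deg≡length-neighbours v) xs<deg)
    = u , neighbours-adjacent u∈ , u∉xs

-- The graph H₇

pattern 𝐚 = zero
pattern 𝐛 = suc zero
pattern 𝐯 = suc (suc zero)
pattern 𝐰 = suc (suc (suc zero))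
pattern 𝐱 = suc (suc (suc (suc zero)))
pattern 𝐲 = suc (suc (suc (suc (suc zero))))
pattern 𝐳 = suc (suc (suc (suc (suc (suc zero)))))

∈ₗ-dec : ∀ {A : Set} → DecidableEquality A → ∀ (x : A) xs → Dec (x ∈ₗ xs)
∈ₗ-dec _≟_ x [] = no λ ()
∈ₗ-dec _≟_ x (y ∷ xs) with x ≟ y | ∈ₗ-dec _≟_ x xs
... | yes refl | _        = yes here
... | no _     | yes x∈xs = yes (there x∈xs)
... | no x≢y   | no x∉xs  = no λ { here → x≢y refl ; (there x∈xs) → x∉xs x∈xs }

_~_ : Fin 7 → Fin 7 → Set
s ~ t = (s , t) ∈ₗ H7-edges ⊎ (t , s) ∈ₗ H7-edges

_~?_ : ∀ s t → Dec (s ~ t)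
s ~? t = ∈ₗ-dec _≟₂_ (s , t) H7-edges ⊎-dec ∈ₗ-dec _≟₂_ (t , s) H7-edges
  where _≟₂_ = ≡-dec Fin._≟_ Fin._≟_

~-sym : ∀ {s t} → s ~ t → t ~ s
~-sym = Sum.swap

H₇-neighbours : Fin 7 → List (Fin 7)
H₇-neighbours s = filter (s ~?_) (allFin 7)

H₇-neighbours-unique : ∀ s → Unique (H₇-neighbours s)
H₇-neighbours-unique s = Unique.filter⁺ (s ~?_) (Unique.allFin⁺ 7)

∈-H₇-neighbours : ∀ {s t} → s ~ t → t ∈ˡ H₇-neighbours s
∈-H₇-neighbours {s} {t} s~t = ∈-filter⁺ (s ~?_) (∈-allFin t) s~t

H₇-neighbours-adjacent : ∀ {s t} → t ∈ˡ H₇-neighbours s → s ~ t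
H₇-neighbours-adjacent {s} = proj₂ ∘ ∈-filter⁻ (s ~?_) {xs = allFin 7}

length-H₇-neighbours : ∀ s → s ≢ 𝐱 → length (H₇-neighbours s) ≡ 3
length-H₇-neighbours 𝐚 _ = refl
length-H₇-neighbours 𝐛 _ = refl
length-H₇-neighbours 𝐯 _ = refl
length-H₇-neighbours 𝐰 _ = refl
length-H₇-neighbours 𝐱 s≢𝐱 = contradiction refl s≢𝐱
length-H₇-neighbours 𝐲 _ = refl
length-H₇-neighbours 𝐳 _ = refl

record Automorphism (σ : Fin 7 → Fin 7) : Set where
  field
    involutive  : ∀ s → σ (σ s) ≡ s
    fixes-𝐱     : σ 𝐱 ≡ 𝐱
    preserves-~ : ∀ s t → s ~ t → σ s ~ σ t

automorphism? : ∀ σ → σ 𝐱 ≡ 𝐱 → Dec (Automorphism σ)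
automorphism? σ fixes-𝐱
  with all? (λ s → σ (σ s) Fin.≟ s) | all? (λ s → all? λ t → (s ~? t) →-dec (σ s ~? σ t))
... | yes inv | yes pres = yes record { involutive = inv ; fixes-𝐱 = fixes-𝐱 ; preserves-~ = pres }
... | no ¬inv | _        = no (¬inv ∘ Automorphism.involutive)
... | _       | no ¬pres = no (¬pres ∘ Automorphism.preserves-~)

swap-ab : Fin 7 → Fin 7
swap-ab 𝐚 = 𝐛
swap-ab 𝐛 = 𝐚
swap-ab s = s

swap-vw-yz : Fin 7 → Fin 7
swap-vw-yz 𝐯 = 𝐰
swap-vw-yz 𝐰 = 𝐯
swap-vw-yz 𝐲 = 𝐳
swap-vw-yz 𝐳 = 𝐲
swap-vw-yz s = s

swap-ab-automorphism : Automorphism swap-ab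
swap-ab-automorphism = from-yes (automorphism? swap-ab refl)

swap-vw-yz-automorphism : Automorphism swap-vw-yz
swap-vw-yz-automorphism = from-yes (automorphism? swap-vw-yz refl)

-- Colouring H₇ from palettes

record Good (P : Fin 7 → Vec ℕ 3) (f : ℕ) (h : Fin 7 → ℕ) : Set where
  field
    in-palette : ∀ s → h s ∈ P s
    proper     : ∀ {s t} → s ~ t → h s ≢ h t
    avoids-f   : h 𝐱 ≢ f

Reachable : (Fin 7 → Vec ℕ 3) → ℕ → Fin 7 → ℕ → Set
Reachable P f s c = ∃ λ h → Good P f h × h s ≡ c

transport : ∀ {σ} → Automorphism σ → ∀ {P f s c} → Reachable (P ∘ σ) f s c → Reachable P f (σ s) c
transport {σ} σ-aut {P} {f} {s} (h , h-good , hs≡c) = h ∘ σ , good , trans (cong h (involutive s)) hs≡c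
  where
  open Automorphism σ-aut
  open Good h-good
  good : Good P f (h ∘ σ)
  good = record
    { in-palette = λ t → subst (λ r → h (σ t) ∈ P r) (involutive t) (in-palette (σ t))
    ; proper     = λ s~t → proper (preserves-~ _ _ s~t)
    ; avoids-f   = subst (λ r → h r ≢ f) (sym fixes-𝐱) avoids-f
    }

module Constructions (P : Fin 7 → Vec ℕ 3) (P! : ∀ s → Distinct (P s)) where

  record Diamond : Set where
    field
      a b v w : ℕ
      a∈ : a ∈ P 𝐚
      b∈ : b ∈ P 𝐛
      v∈ : v ∈ P 𝐯
      w∈ : w ∈ P 𝐰
      a≢b : a ≢ b
      a≢w : a ≢ w
      b≢w : b ≢ w
      a≢v : a ≢ v
      b≢v : b ≢ v

  record Triangle (f : ℕ) : Set where
    field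
      x y z : ℕ
      x∈ : x ∈ P 𝐱
      y∈ : y ∈ P 𝐲
      z∈ : z ∈ P 𝐳
      x≢y : x ≢ y
      x≢z : x ≢ z
      y≢z : y ≢ z
      x≢f : x ≢ f

  module _ {f : ℕ} (D : Diamond) (T : Triangle f) where
    open Diamond D
    open Triangle T

    glue : Fin 7 → ℕ
    glue 𝐚 = a
    glue 𝐛 = b
    glue 𝐯 = v
    glue 𝐰 = w
    glue 𝐱 = x
    glue 𝐲 = y
    glue 𝐳 = z

    glue-good : v ≢ z → w ≢ y → Good P f glue
    glue-good v≢z w≢y = record { in-palette = in-palette ; proper = proper ; avoids-f = x≢f }
      where
      in-palette : ∀ s → glue s ∈ P s
      in-palette 𝐚 = a∈
      in-palette 𝐛 = b∈
      in-palette 𝐯 = v∈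
      in-palette 𝐰 = w∈
      in-palette 𝐱 = x∈
      in-palette 𝐲 = y∈
      in-palette 𝐳 = z∈
      proper-edge : ∀ {s t} → (s , t) ∈ₗ H7-edges → glue s ≢ glue t
      proper-edge here = a≢b
      proper-edge (there here) = a≢w
      proper-edge (there (there here)) = b≢w
      proper-edge (there (there (there here))) = a≢v
      proper-edge (there (there (there (there here)))) = b≢v
      proper-edge (there (there (there (there (there here))))) = v≢z
      proper-edge (there (there (there (there (there (there here)))))) = w≢y
      proper-edge (there (there (there (there (there (there (there here))))))) = x≢y
      proper-edge (there (there (there (there (there (there (there (there here)))))))) = x≢z
      proper-edge (there (there (there (there (there (there (there (there (there here))))))))) = y≢z
      proper : ∀ {s t} → s ~ t → glue s ≢ glue t
      proper (inj₁ st∈E) = proper-edge st∈E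
      proper (inj₂ ts∈E) = ≢-sym (proper-edge ts∈E)

    glue-reaches : v ≢ z → w ≢ y → ∀ s → Reachable P f s (glue s)
    glue-reaches v≢z w≢y s = glue , glue-good v≢z w≢y , refl

  diamond-from : ∀ {v w} → v ∈ P 𝐯 → w ∈ P 𝐰 → AtMostOneIn (P 𝐚) v w → Diamond
  diamond-from {v} {w} v∈ w∈ one
    with b , b∈ , b≢v , b≢w ← avoid₂ (P! 𝐛) v w
    with a , a∈ , a≢v , a≢w , a≢b ← avoid₃ (P! 𝐚) one b
    = record { a = a ; b = b ; v = v ; w = w ; a∈ = a∈ ; b∈ = b∈ ; v∈ = v∈ ; w∈ = w∈
             ; a≢b = a≢b ; a≢w = a≢w ; b≢w = b≢w ; a≢v = a≢v ; b≢v = b≢v }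

  opaque
    -- diamond-from applies unless each admissible v-colour and w-colour are distinct colours of
    -- P 𝐚; with two admissible colours on each side that would put four colours into P 𝐚.
    diamond : ∀ pv pw → Σ Diamond λ D → Diamond.v D ≢ pv × Diamond.w D ≢ pw
    diamond pv pw
      with v₁ , v₂ , v₁∈ , v₂∈ , v₁≢v₂ , v₁≢pv , v₂≢pv ← two-avoiding (P! 𝐯) pv
      with w₁ , w₂ , w₁∈ , w₂∈ , w₁≢w₂ , w₁≢pw , w₂≢pw ← two-avoiding (P! 𝐰) pw
      with atMostOneIn? (P 𝐚) v₁ w₁ | atMostOneIn? (P 𝐚) v₁ w₂
         | atMostOneIn? (P 𝐚) v₂ w₁ | atMostOneIn? (P 𝐚) v₂ w₂
    ... | yes one | _       | _       | _       = diamond-from v₁∈ w₁∈ one , v₁≢pv , w₁≢pw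
    ... | no _    | yes one | _       | _       = diamond-from v₁∈ w₂∈ one , v₁≢pv , w₂≢pw
    ... | no _    | no _    | yes one | _       = diamond-from v₂∈ w₁∈ one , v₂≢pv , w₁≢pw
    ... | no _    | no _    | no _    | yes one = diamond-from v₂∈ w₂∈ one , v₂≢pv , w₂≢pw
    ... | no ¬one₁₁ | no ¬one₁₂ | no ¬one₂₁ | no ¬one₂₂
      with v₁∈a , w₁∈a , v₁≢w₁ ← ¬atMostOneIn ¬one₁₁
      with _ , w₂∈a , v₁≢w₂ ← ¬atMostOneIn ¬one₁₂
      with v₂∈a , _ , v₂≢w₁ ← ¬atMostOneIn ¬one₂₁
      with _ , _ , v₂≢w₂ ← ¬atMostOneIn ¬one₂₂
      = ⊥-elim (no-four-distinct v₁∈a v₂∈a w₁∈a w₂∈a v₁≢v₂ v₁≢w₁ v₁≢w₂ v₂≢w₁ v₂≢w₂ w₁≢w₂)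

  extend-triangle : ∀ {f} → Triangle f → Fin 7 → ℕ
  extend-triangle T = glue (proj₁ (diamond (Triangle.z T) (Triangle.y T))) T

  extend-triangle-reaches : ∀ {f} (T : Triangle f) s → Reachable P f s (extend-triangle T s)
  extend-triangle-reaches T with D , v≢z , w≢y ← diamond (Triangle.z T) (Triangle.y T) =
    glue-reaches D T v≢z w≢y

  opaque
    reachable-x : ∀ {f c} → c ∈ P 𝐱 → c ≢ f → Reachable P f 𝐱 c
    reachable-x {f} {c} c∈ c≢f
      with y , y∈ , y≢c , _ ← avoid₂ (P! 𝐲) c c
      with z , z∈ , z≢c , z≢y ← avoid₂ (P! 𝐳) c y
      = extend-triangle-reaches T 𝐱
      where
      T : Triangle f
      T = record { x = c ; y = y ; z = z ; x∈ = c∈ ; y∈ = y∈ ; z∈ = z∈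
                 ; x≢y = ≢-sym y≢c ; x≢z = ≢-sym z≢c ; y≢z = ≢-sym z≢y ; x≢f = c≢f }

    reachable-y : ∀ {f c} → c ∈ P 𝐲 → Reachable P f 𝐲 c
    reachable-y {f} {c} c∈
      with x , x∈ , x≢c , x≢f ← avoid₂ (P! 𝐱) c f
      with z , z∈ , z≢c , z≢x ← avoid₂ (P! 𝐳) c x
      = extend-triangle-reaches T 𝐲
      where
      T : Triangle f
      T = record { x = x ; y = c ; z = z ; x∈ = x∈ ; y∈ = c∈ ; z∈ = z∈
                 ; x≢y = x≢c ; x≢z = ≢-sym z≢x ; y≢z = ≢-sym z≢c ; x≢f = x≢f }

    reachable-a-via-v≡x : ∀ {f c x₁} → c ∈ P 𝐚 → x₁ ∈ P 𝐱 → x₁ ≢ f → x₁ ∈ P 𝐯 → x₁ ≢ c → Reachable P f 𝐚 c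
    reachable-a-via-v≡x {f} {c} {x₁} c∈ x₁∈ x₁≢f x₁∈v x₁≢c
      with b , b∈ , b≢c , b≢x₁ ← avoid₂ (P! 𝐛) c x₁
      with w , w∈ , w≢c , w≢b ← avoid₂ (P! 𝐰) c b
      with y , y∈ , y≢w , y≢x₁ ← avoid₂ (P! 𝐲) w x₁
      with z , z∈ , z≢x₁ , z≢y ← avoid₂ (P! 𝐳) x₁ y
      = glue-reaches D T (≢-sym z≢x₁) (≢-sym y≢w) 𝐚
      where
      D : Diamond
      D = record { a = c ; b = b ; v = x₁ ; w = w ; a∈ = c∈ ; b∈ = b∈ ; v∈ = x₁∈v ; w∈ = w∈
                 ; a≢b = ≢-sym b≢c ; a≢w = ≢-sym w≢c ; b≢w = ≢-sym w≢b ; a≢v = ≢-sym x₁≢c ; b≢v = b≢x₁ }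
      T : Triangle f
      T = record { x = x₁ ; y = y ; z = z ; x∈ = x₁∈ ; y∈ = y∈ ; z∈ = z∈
                 ; x≢y = ≢-sym y≢x₁ ; x≢z = ≢-sym z≢x₁ ; y≢z = ≢-sym z≢y ; x≢f = x₁≢f }

    reachable-a-via-x∉Pz : ∀ {f c x₁} → c ∈ P 𝐚 → x₁ ∈ P 𝐱 → x₁ ≢ f → x₁ ∉ P 𝐳 → Reachable P f 𝐚 c
    reachable-a-via-x∉Pz {f} {c} {x₁} c∈ x₁∈ x₁≢f x₁∉z
      with b , b∈ , b≢c , _ ← avoid₂ (P! 𝐛) c c
      with w , w∈ , w≢c , w≢b ← avoid₂ (P! 𝐰) c b
      with v , v∈ , v≢c , v≢b ← avoid₂ (P! 𝐯) c b
      with y , y∈ , y≢w , y≢x₁ ← avoid₂ (P! 𝐲) w x₁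
      with z , z∈ , z≢y , z≢v ← avoid₂ (P! 𝐳) y v
      = glue-reaches D T (≢-sym z≢v) (≢-sym y≢w) 𝐚
      where
      D : Diamond
      D = record { a = c ; b = b ; v = v ; w = w ; a∈ = c∈ ; b∈ = b∈ ; v∈ = v∈ ; w∈ = w∈
                 ; a≢b = ≢-sym b≢c ; a≢w = ≢-sym w≢c ; b≢w = ≢-sym w≢b ; a≢v = ≢-sym v≢c ; b≢v = ≢-sym v≢b }
      T : Triangle f
      T = record { x = x₁ ; y = y ; z = z ; x∈ = x₁∈ ; y∈ = y∈ ; z∈ = z∈
                 ; x≢y = ≢-sym y≢x₁ ; x≢z = λ x₁≡z → x₁∉z (subst (_∈ P 𝐳) (sym x₁≡z) z∈)
                 ; y≢z = ≢-sym z≢y ; x≢f = x₁≢f }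

    reachable-a-via-z≡x₁ : ∀ {f c x₁ x₂} → c ∈ P 𝐚 → x₁ ∈ P 𝐳 → ¬ (x₁ ∈ P 𝐯 × x₁ ≢ c) →
      x₂ ∈ P 𝐱 → x₂ ≢ f → x₂ ≢ x₁ → Reachable P f 𝐚 c
    reachable-a-via-z≡x₁ {f} {c} {x₁} {x₂} c∈ x₁∈z ¬x₁∈v x₂∈ x₂≢f x₂≢x₁
      with y , y∈ , y≢x₁ , y≢x₂ ← avoid₂ (P! 𝐲) x₁ x₂
      with w , w∈ , w≢c , w≢y ← avoid₂ (P! 𝐰) c y
      with b , b∈ , b≢c , b≢w ← avoid₂ (P! 𝐛) c w
      with v , v∈ , v≢c , v≢b ← avoid₂ (P! 𝐯) c b
      = glue-reaches D T v≢x₁ w≢y 𝐚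
      where
      D : Diamond
      D = record { a = c ; b = b ; v = v ; w = w ; a∈ = c∈ ; b∈ = b∈ ; v∈ = v∈ ; w∈ = w∈
                 ; a≢b = ≢-sym b≢c ; a≢w = ≢-sym w≢c ; b≢w = b≢w ; a≢v = ≢-sym v≢c ; b≢v = ≢-sym v≢b }
      T : Triangle f
      T = record { x = x₂ ; y = y ; z = x₁ ; x∈ = x₂∈ ; y∈ = y∈ ; z∈ = x₁∈z
                 ; x≢y = ≢-sym y≢x₂ ; x≢z = x₂≢x₁ ; y≢z = y≢x₁ ; x≢f = x₂≢f }
      v≢x₁ : v ≢ x₁
      v≢x₁ v≡x₁ = ¬x₁∈v (subst (_∈ P 𝐯) v≡x₁ v∈ , λ x₁≡c → v≢c (trans v≡x₁ x₁≡c))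

    reachable-a : ∀ {f c} → c ∈ P 𝐚 → Reachable P f 𝐚 c
    reachable-a {f} {c} c∈
      with x₁ , x₂ , x₁∈ , x₂∈ , x₁≢x₂ , x₁≢f , x₂≢f ← two-avoiding (P! 𝐱) f
      with x₁ ∈? P 𝐯 ×-dec ¬? (x₁ ℕ.≟ c) | x₁ ∈? P 𝐳
    ... | yes (x₁∈v , x₁≢c) | _        = reachable-a-via-v≡x c∈ x₁∈ x₁≢f x₁∈v x₁≢c
    ... | no ¬x₁∈v          | no x₁∉z  = reachable-a-via-x∉Pz c∈ x₁∈ x₁≢f x₁∉z
    ... | no ¬x₁∈v          | yes x₁∈z = reachable-a-via-z≡x₁ c∈ x₁∈z ¬x₁∈v x₂∈ x₂≢f (≢-sym x₁≢x₂)

    reachable-v : ∀ {f c x} → c ∈ P 𝐯 → x ∈ P 𝐱 → x ≢ f → AtMostOneIn (P 𝐳) c x → Reachable P f 𝐯 c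
    reachable-v {f} {c} {x} c∈ x∈ x≢f one-z
      with w , w∈ , one-a ← ∃-atMostOneIn (P! 𝐚) (P! 𝐰) c
      with b , b∈ , b≢c , b≢w ← avoid₂ (P! 𝐛) c w
      with a , a∈ , a≢c , a≢w , a≢b ← avoid₃ (P! 𝐚) one-a b
      with y , y∈ , y≢w , y≢x ← avoid₂ (P! 𝐲) w x
      with z , z∈ , z≢c , z≢x , z≢y ← avoid₃ (P! 𝐳) one-z y
      = glue-reaches D T (≢-sym z≢c) (≢-sym y≢w) 𝐯
      where
      D : Diamond
      D = record { a = a ; b = b ; v = c ; w = w ; a∈ = a∈ ; b∈ = b∈ ; v∈ = c∈ ; w∈ = w∈
                 ; a≢b = a≢b ; a≢w = a≢w ; b≢w = b≢w ; a≢v = a≢c ; b≢v = b≢c }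
      T : Triangle f
      T = record { x = x ; y = y ; z = z ; x∈ = x∈ ; y∈ = y∈ ; z∈ = z∈
                 ; x≢y = ≢-sym y≢x ; x≢z = ≢-sym z≢x ; y≢z = ≢-sym z≢y ; x≢f = x≢f }

  reachable-v-or-blocked : ∀ {f c} → c ∈ P 𝐯 → Reachable P f 𝐯 c ⊎ Blocked (P 𝐱) f (P 𝐳) c
  reachable-v-or-blocked {f} {c} c∈ with blocked? (P 𝐱) f (P 𝐳) c
  ... | inj₁ (x , x∈ , x≢f , one-z) = inj₁ (reachable-v c∈ x∈ x≢f one-z)
  ... | inj₂ blocked = inj₂ blocked

module _ (P : Fin 7 → Vec ℕ 3) (P! : ∀ s → Distinct (P s)) where
  open Constructions

  BlockedAt : ℕ → Fin 7 → ℕ → Set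
  BlockedAt f 𝐯 c = Blocked (P 𝐱) f (P 𝐳) c
  BlockedAt f 𝐰 c = Blocked (P 𝐱) f (P 𝐲) c
  BlockedAt f 𝐱 c = c ≡ f
  BlockedAt f _ c = ⊥

  reachable-or-blocked : ∀ f s {c} → c ∈ P s → Reachable P f s c ⊎ BlockedAt f s c
  reachable-or-blocked f 𝐚 c∈ = inj₁ (reachable-a P P! c∈)
  reachable-or-blocked f 𝐛 c∈ =
    inj₁ (transport swap-ab-automorphism (reachable-a (P ∘ swap-ab) (P! ∘ swap-ab) c∈))
  reachable-or-blocked f 𝐯 c∈ = reachable-v-or-blocked P P! c∈
  reachable-or-blocked f 𝐰 c∈ =
    Sum.map₁ (transport swap-vw-yz-automorphism)
             (reachable-v-or-blocked (P ∘ swap-vw-yz) (P! ∘ swap-vw-yz) c∈)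
  reachable-or-blocked f 𝐱 {c} c∈ with c ℕ.≟ f
  ... | yes c≡f = inj₂ c≡f
  ... | no  c≢f = inj₁ (reachable-x P P! c∈ c≢f)
  reachable-or-blocked f 𝐲 c∈ = inj₁ (reachable-y P P! c∈)
  reachable-or-blocked f 𝐳 c∈ =
    inj₁ (transport swap-vw-yz-automorphism (reachable-y (P ∘ swap-vw-yz) (P! ∘ swap-vw-yz) c∈))

  blockedAt-unique : ∀ {f} s {c c′} → BlockedAt f s c → BlockedAt f s c′ → c ≡ c′
  blockedAt-unique 𝐯 = blocked-unique (P! 𝐱)
  blockedAt-unique 𝐰 = blocked-unique (P! 𝐱)
  blockedAt-unique 𝐱 c≡f c′≡f = trans c≡f (sym c′≡f)

  blockedAt-forced : ∀ s c → ∃ λ f₀ → ∀ f → BlockedAt f s c → f ≡ f₀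
  blockedAt-forced 𝐚 c = 0 , λ _ ()
  blockedAt-forced 𝐛 c = 0 , λ _ ()
  blockedAt-forced 𝐯 c = blocked-forced (P! 𝐱) c
  blockedAt-forced 𝐰 c = blocked-forced (P! 𝐱) c
  blockedAt-forced 𝐱 c = c , λ _ c≡f → sym c≡f
  blockedAt-forced 𝐲 c = 0 , λ _ ()
  blockedAt-forced 𝐳 c = 0 , λ _ ()

  data Coverage (f : ℕ) (s : Fin 7) : Set where
    all-reachable : (∀ i → Reachable P f s (lookup (P s) i)) → Coverage f s
    one-blocked   : ∀ j → BlockedAt f s (lookup (P s) j) →
                    (∀ k → Reachable P f s (lookup (P s) (punchIn j k))) → Coverage f s

  opaque
    coverage : ∀ f s → Coverage f s
    coverage f s with all⊎∃ (λ i → reachable-or-blocked f s (lookup-∈ i (P s)))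
    ... | inj₁ reachable = all-reachable reachable
    ... | inj₂ (j , j-blocked) = one-blocked j j-blocked others
      where
      others : ∀ k → Reachable P f s (lookup (P s) (punchIn j k))
      others k with reachable-or-blocked f s (lookup-∈ (punchIn j k) (P s))
      ... | inj₁ reachable = reachable
      ... | inj₂ k-blocked =
        contradiction (P! s _ _ (blockedAt-unique s k-blocked j-blocked)) (punchInᵢ≢i j k)

  block : ∀ {f s} → Coverage f s → List (Fin 7 → ℕ)
  block (all-reachable reach) = h₀ ∷ h₀ ∷ h₁ ∷ h₁ ∷ h₂ ∷ h₂ ∷ []
    where
    h₀ h₁ h₂ : Fin 7 → ℕ
    h₀ = proj₁ (reach zero)
    h₁ = proj₁ (reach (suc zero))
    h₂ = proj₁ (reach (suc (suc zero)))
  block (one-blocked j _ reach) = h₀ ∷ h₀ ∷ h₀ ∷ h₁ ∷ h₁ ∷ h₁ ∷ []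
    where
    h₀ h₁ : Fin 7 → ℕ
    h₀ = proj₁ (reach zero)
    h₁ = proj₁ (reach (suc zero))

  block-length : ∀ {f s} (cov : Coverage f s) → length (block cov) ≡ 6
  block-length (all-reachable _)   = refl
  block-length (one-blocked _ _ _) = refl

  block-good : ∀ {f s} (cov : Coverage f s) → All (Good P f) (block cov)
  block-good {f} (all-reachable reach) = g₀ ∷ g₀ ∷ g₁ ∷ g₁ ∷ g₂ ∷ g₂ ∷ []
    where
    g₀ : Good P f (proj₁ (reach zero))
    g₁ : Good P f (proj₁ (reach (suc zero)))
    g₂ : Good P f (proj₁ (reach (suc (suc zero))))
    g₀ = proj₁ (proj₂ (reach zero))
    g₁ = proj₁ (proj₂ (reach (suc zero)))
    g₂ = proj₁ (proj₂ (reach (suc (suc zero))))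
  block-good {f} (one-blocked j _ reach) = g₀ ∷ g₀ ∷ g₀ ∷ g₁ ∷ g₁ ∷ g₁ ∷ []
    where
    g₀ : Good P f (proj₁ (reach zero))
    g₁ : Good P f (proj₁ (reach (suc zero)))
    g₀ = proj₁ (proj₂ (reach zero))
    g₁ = proj₁ (proj₂ (reach (suc zero)))

  distinct-colours : ∀ {f s i j d} → i ≢ j →
    (rᵢ : Reachable P f s (lookup (P s) i)) (rⱼ : Reachable P f s (lookup (P s) j)) →
    not (coloured s d (proj₁ rᵢ)) ≡ false → not (coloured s d (proj₁ rⱼ)) ≡ false → ⊥
  distinct-colours {s = s} {i} {j} i≢j (hᵢ , _ , hᵢs≡) (hⱼ , _ , hⱼs≡) hᵢs≡d hⱼs≡d =
    i≢j (P! s i j (trans (sym hᵢs≡)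
                  (trans (not-coloured⁻ hᵢ hᵢs≡d) (trans (sym (not-coloured⁻ hⱼ hⱼs≡d)) hⱼs≡))))

  block-avoids : ∀ {f s} (cov : Coverage f s) d → 3 ℕ.≤ count (not ∘ coloured s d) (block cov)
  block-avoids {s = s} (all-reachable reach) d =
    count-pairs-≥3 (not ∘ coloured s d)
      (proj₁ (reach zero)) (proj₁ (reach (suc zero))) (proj₁ (reach (suc (suc zero))))
      (distinct-colours (λ ()) (reach zero) (reach (suc zero)))
      (distinct-colours (λ ()) (reach zero) (reach (suc (suc zero))))
      (distinct-colours (λ ()) (reach (suc zero)) (reach (suc (suc zero))))
  block-avoids {s = s} (one-blocked j _ reach) d =
    count-triples-≥3 (not ∘ coloured s d) (proj₁ (reach zero)) (proj₁ (reach (suc zero)))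
      (distinct-colours (λ eq → contradiction (punchIn-injective j zero (suc zero) eq) λ ())
                        (reach zero) (reach (suc zero)))

  block-hits : ∀ {f s} (cov : Coverage f s) i → ¬ BlockedAt f s (lookup (P s) i) →
    2 ℕ.≤ count (coloured s (lookup (P s) i)) (block cov)
  block-hits {s = s} (all-reachable reach) i _ = hits i
    where
    h : Fin 3 → Fin 7 → ℕ
    h i = proj₁ (reach i)
    hit : ∀ i → coloured s (lookup (P s) i) (h i) ≡ true
    hit i = coloured⁺ (h i) (proj₂ (proj₂ (reach i)))
    hits : ∀ i → 2 ℕ.≤ count (coloured s (lookup (P s) i)) (block (all-reachable reach))
    hits zero = count-≥2 (coloured s _) (h zero) (hit zero) []
      (h (suc zero) ∷ h (suc zero) ∷ h (suc (suc zero)) ∷ h (suc (suc zero)) ∷ [])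
    hits (suc zero) = count-≥2 (coloured s _) (h (suc zero)) (hit (suc zero)) (h zero ∷ h zero ∷ [])
      (h (suc (suc zero)) ∷ h (suc (suc zero)) ∷ [])
    hits (suc (suc zero)) = count-≥2 (coloured s _) (h (suc (suc zero))) (hit (suc (suc zero)))
      (h zero ∷ h zero ∷ h (suc zero) ∷ h (suc zero) ∷ []) []
  block-hits {f} {s} (one-blocked j j-blocked reach) i ¬i-blocked with j Fin.≟ i
  ... | yes refl = contradiction j-blocked ¬i-blocked
  ... | no  j≢i  = subst (λ i′ → 2 ℕ.≤ count (coloured s (lookup (P s) i′)) (block cov))
                         (punchIn-punchOut j≢i) (hits (punchOut j≢i))
    where
    h : Fin 2 → Fin 7 → ℕ
    h k = proj₁ (reach k)
    hit : ∀ k → coloured s (lookup (P s) (punchIn j k)) (h k) ≡ true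
    hit k = coloured⁺ (h k) (proj₂ (proj₂ (reach k)))
    cov : Coverage f s
    cov = one-blocked j j-blocked reach
    hits : ∀ k → 2 ℕ.≤ count (coloured s (lookup (P s) (punchIn j k))) (block cov)
    hits zero = count-≥2 (coloured s _) (h zero) (hit zero) []
      (h zero ∷ h (suc zero) ∷ h (suc zero) ∷ h (suc zero) ∷ [])
    hits (suc zero) = count-≥2 (coloured s _) (h (suc zero)) (hit (suc zero)) (h zero ∷ h zero ∷ h zero ∷ [])
      (h (suc zero) ∷ [])

  opaque
    colourings : ℕ → List (Fin 7 → ℕ)
    colourings f = List.concat (List.tabulate (λ s → block (coverage f s)))

    colourings-length : ∀ f → length (colourings f) ≡ 42
    colourings-length f =
      length-concat-tabulate 7 (λ s → block (coverage f s)) (λ s → block-length (coverage f s))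

    colourings-good : ∀ f → All (Good P f) (colourings f)
    colourings-good f = All.concat⁺ (All.tabulate⁺ (λ s → block-good (coverage f s)))

    block∈colourings : ∀ f s → block (coverage f s) ∈ˡ List.tabulate (λ s → block (coverage f s))
    block∈colourings f s = ∈-tabulate⁺ {f = λ s → block (coverage f s)} s

    colourings-avoid : ∀ f s d → 3 ℕ.≤ count (not ∘ coloured s d) (colourings f)
    colourings-avoid f s d =
      ℕ.≤-trans (block-avoids (coverage f s) d) (count-concat-≥ (not ∘ coloured s d) (block∈colourings f s))

    colourings-hit : ∀ f s {c} → c ∈ P s → ¬ BlockedAt f s c → 2 ℕ.≤ count (coloured s c) (colourings f)
    colourings-hit f s {c} c∈ c-unblocked =
      subst (λ c′ → 2 ℕ.≤ count (coloured s c′) (colourings f)) (sym c≡lookup) hits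
      where
      i : Fin 3
      i = VecAny.index c∈
      c≡lookup : c ≡ lookup (P s) i
      c≡lookup = VecAny.lookup-index c∈
      hits : 2 ℕ.≤ count (coloured s (lookup (P s) i)) (colourings f)
      hits = ℕ.≤-trans (block-hits (coverage f s) i (c-unblocked ∘ subst (BlockedAt f s) (sym c≡lookup)))
                       (count-concat-≥ (coloured s (lookup (P s) i)) (block∈colourings f s))

-- Extending colourings of G ∖ H₇

does-true⇒ : ∀ {A : Set} (a? : Dec A) → does a? ≡ true → A
does-true⇒ (yes a) _ = a

module Copy (G : Graph) (H : H7-in G) (deg≡3 : ∀ s → deg G (emb H s) ≡ 3) where

  ι : Fin 7 → Fin (n G)
  ι = emb H

  ι-adjacent : ∀ {s t} → s ~ t → adj G (ι s) (ι t) ≡ true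
  ι-adjacent (inj₁ st∈E) = emb-edge H _ _ st∈E
  ι-adjacent (inj₂ ts∈E) = trans (adj-sym G _ _) (emb-edge H _ _ ts∈E)

  image-neighbours : Fin 7 → List (Fin (n G))
  image-neighbours s = List.map ι (H₇-neighbours s)

  image-neighbours-unique : ∀ s → Unique (image-neighbours s)
  image-neighbours-unique s = Unique.map⁺ (emb-inj H _ _) (H₇-neighbours-unique s)

  image-neighbours-adjacent : ∀ s → All (λ u → adj G (ι s) u ≡ true) (image-neighbours s)
  image-neighbours-adjacent s = All.map⁺ (All.tabulate (ι-adjacent ∘ H₇-neighbours-adjacent))

  from-image-neighbours : ∀ {s u} → u ∈ˡ image-neighbours s → ∃ λ t → s ~ t × u ≡ ι t
  from-image-neighbours u∈ with t , t∈ , u≡ιt ← ∈-map⁻ ι u∈ = t , H₇-neighbours-adjacent t∈ , u≡ιt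

  opaque
    external : ∃ λ u → adj G (ι 𝐱) u ≡ true × u ∉ˡ image-neighbours 𝐱
    external = ∃-adjacent-∉ G (ℕ.≤-reflexive (sym (deg≡3 𝐱)))

  x′ : Fin (n G)
  x′ = proj₁ external

  𝐱~x′ : adj G (ι 𝐱) x′ ≡ true
  𝐱~x′ = proj₁ (proj₂ external)

  x′∉ : x′ ∉ˡ image-neighbours 𝐱
  x′∉ = proj₂ (proj₂ external)

  image-adjacent : ∀ s {u} → adj G (ι s) u ≡ true → (∃ λ t → s ~ t × u ≡ ι t) ⊎ (s ≡ 𝐱 × u ≡ x′)
  image-adjacent s s~u with s Fin.≟ 𝐱
  ... | no s≢𝐱 = inj₁ (from-image-neighbours
      (adjacent-∈ G deg≡length (image-neighbours-unique s) (image-neighbours-adjacent s) s~u))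
    where
    deg≡length : deg G (ι s) ≡ length (image-neighbours s)
    deg≡length = trans (deg≡3 s) (sym (trans (length-map ι (H₇-neighbours s)) (length-H₇-neighbours s s≢𝐱)))
  ... | yes refl
    with adjacent-∈ G (deg≡3 𝐱) (All.tabulate (λ { u∈ refl → x′∉ u∈ }) ∷ image-neighbours-unique 𝐱)
                                (𝐱~x′ ∷ image-neighbours-adjacent 𝐱) s~u
  ... | here u≡x′ = inj₂ (refl , u≡x′)
  ... | there u∈  = inj₁ (from-image-neighbours u∈)

  x′-outside : ∀ t → ι t ≢ x′
  x′-outside t ιt≡x′ = Sum.[ via-H₇-edge , via-x′ ]′ (image-adjacent t (trans (adj-sym G _ _) 𝐱~ιt))
    where
    𝐱~ιt : adj G (ι 𝐱) (ι t) ≡ true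
    𝐱~ιt = subst (λ u → adj G (ι 𝐱) u ≡ true) (sym ιt≡x′) 𝐱~x′
    via-H₇-edge : (∃ λ t′ → t ~ t′ × ι 𝐱 ≡ ι t′) → ⊥
    via-H₇-edge (t′ , t~t′ , ι𝐱≡ιt′) with refl ← emb-inj H _ _ ι𝐱≡ιt′ =
      x′∉ (subst (_∈ˡ image-neighbours 𝐱) ιt≡x′ (∈-map⁺ ι (∈-H₇-neighbours (~-sym t~t′))))
    via-x′ : t ≡ 𝐱 × ι 𝐱 ≡ x′ → ⊥
    via-x′ (refl , _) = contradiction (trans (sym 𝐱~ιt) (irrefl G (ι 𝐱))) λ ()

  image? : ∀ u → Dec (∃ λ s → ι s ≡ u)
  image? u = any? (λ s → ι s Fin.≟ u)

  S : Subset (n G)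
  S = Vec.tabulate (does ∘ image?)

  ι∈S : ∀ s → ι s ∈ₛ S
  ι∈S s =
    lookup⇒[]= (ι s) S (trans (lookup∘tabulate (does ∘ image?) (ι s)) (dec-true (image? (ι s)) (s , refl)))

  ∈S⇒image : ∀ {u} → u ∈ₛ S → ∃ λ s → ι s ≡ u
  ∈S⇒image {u} u∈S =
    does-true⇒ (image? u) (trans (sym (lookup∘tabulate (does ∘ image?) u)) ([]=⇒lookup u∈S))

  ∉image⇒∈∁S : ∀ {u} → ¬ (∃ λ s → ι s ≡ u) → u ∈ₛ ∁ S
  ∉image⇒∈∁S ¬image = x∉p⇒x∈∁p (¬image ∘ ∈S⇒image)

  x′∈∁S : x′ ∈ₛ ∁ S
  x′∈∁S = ∉image⇒∈∁S λ (t , ιt≡x′) → x′-outside t ιt≡x′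

  merge : (Fin (n G) → ℕ) → (Fin 7 → ℕ) → Fin (n G) → ℕ
  merge ψ h u with image? u
  ... | yes (s , _) = h s
  ... | no  _       = ψ u

  merge-image : ∀ ψ h s → merge ψ h (ι s) ≡ h s
  merge-image ψ h s with image? (ι s)
  ... | yes (t , ιt≡ιs) = cong h (emb-inj H t s ιt≡ιs)
  ... | no ¬image       = contradiction (s , refl) ¬image

  merge-outside : ∀ ψ h {u} → ¬ (∃ λ s → ι s ≡ u) → merge ψ h u ≡ ψ u
  merge-outside ψ h {u} ¬image with image? u
  ... | yes image = contradiction image ¬image
  ... | no  _     = refl

  module _ (L : Assignment3 G) where

    P : Fin 7 → Vec ℕ 3
    P = lists L ∘ ι

    P! : ∀ s → Distinct (P s)
    P! s = distinct L (ι s)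

    merge-colouring : ∀ {ψ h} → IsLColoring G L (∁ S) ψ → Good P (ψ x′) h → IsLColoring G L full (merge ψ h)
    merge-colouring {ψ} {h} (ψ∈L , ψ-proper) h-good = (λ u _ → merge∈L u) , (λ u v _ _ → merge-proper u v)
      where
      open Good h-good
      merge∈L : ∀ u → merge ψ h u ∈L L at u
      merge∈L u with image? u
      ... | yes (s , refl) = in-palette s
      ... | no ¬image      = ψ∈L u (∉image⇒∈∁S ¬image)
      merge-proper : ∀ u v → adj G u v ≡ true → merge ψ h u ≢ merge ψ h v
      merge-proper u v u~v with image? u | image? v
      ... | yes (s , refl) | yes (t , refl) with image-adjacent s u~v
      ...   | inj₁ (t′ , s~t′ , ιt≡ιt′) rewrite emb-inj H _ _ ιt≡ιt′ = proper s~t′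
      ...   | inj₂ (_ , ιt≡x′) = contradiction ιt≡x′ (x′-outside t)
      merge-proper u v u~v | yes (s , refl) | no ¬image with image-adjacent s u~v
      ...   | inj₁ (t′ , _ , v≡ιt′) = contradiction (t′ , sym v≡ιt′) ¬image
      ...   | inj₂ (refl , refl) = avoids-f
      merge-proper u v u~v | no ¬image | yes (t , refl) with image-adjacent t (trans (adj-sym G _ _) u~v)
      ...   | inj₁ (s′ , _ , u≡ιs′) = contradiction (s′ , sym u≡ιs′) ¬image
      ...   | inj₂ (refl , refl) = ≢-sym avoids-f
      merge-proper u v u~v | no ¬imageᵤ | no ¬imageᵥ =
        ψ-proper u v (∉image⇒∈∁S ¬imageᵤ) (∉image⇒∈∁S ¬imageᵥ) u~v

    1/42 : ℚ
    1/42 = ℤ.+ 1 / 42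

    extensions : (Fin (n G) → ℕ) → List (Fin 7 → ℕ)
    extensions ψ = colourings P P! (ψ x′)

    kernel : (Fin (n G) → ℕ) → Dist (n G)
    kernel ψ = uniform 1/42 (List.map (merge ψ) (extensions ψ))

    kernel-nonneg : ∀ ψ → NonNegWeights (kernel ψ)
    kernel-nonneg ψ =
      AllD-uniform 1/42 (All.universal (λ _ → ℚ.nonNegative⁻¹ 1/42) (List.map (merge ψ) (extensions ψ)))

    Pr-kernel : ∀ ψ E → Pr (kernel ψ) E ≡ count (E ∘ merge ψ) (extensions ψ) · 1/42
    Pr-kernel ψ E = trans (Pr-uniform 1/42 (List.map (merge ψ) (extensions ψ)) E)
                          (cong (_· 1/42) (count-map E (merge ψ) (extensions ψ)))

    kernel-const : ∀ ψ b → Pr (kernel ψ) (λ _ → b) ≡ (if b then 1ℚ else 0ℚ)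
    kernel-const ψ b = begin
      Pr (kernel ψ) (λ _ → b)                      ≡⟨ Pr-kernel ψ (λ _ → b) ⟩
      count (λ _ → b) (extensions ψ) · 1/42         ≡⟨ cong (_· 1/42) (count-const b (extensions ψ)) ⟩
      (if b then length (extensions ψ) else 0) · 1/42
        ≡⟨ cong (λ m → (if b then m else 0) · 1/42) (colourings-length P P! (ψ x′)) ⟩
      (if b then 42 else 0) · 1/42                  ≡⟨ if-float (_· 1/42) b ⟩
      (if b then 1ℚ else 0ℚ)                        ∎
      where open ≡-Reasoning

    kernel-outside : ∀ ψ {u} → ¬ (∃ λ s → ι s ≡ u) → ∀ (e : ℕ → Bool) →
      Pr (kernel ψ) (λ φ → e (φ u)) ≡ (if e (ψ u) then 1ℚ else 0ℚ)
    kernel-outside ψ {u} ¬image e = begin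
      Pr (kernel ψ) (λ φ → e (φ u))                   ≡⟨ Pr-kernel ψ _ ⟩
      count (λ h → e (merge ψ h u)) (extensions ψ) · 1/42
        ≡⟨ cong (_· 1/42) (count-cong _ (λ h → cong e (merge-outside ψ h ¬image)) (extensions ψ)) ⟩
      count (λ _ → e (ψ u)) (extensions ψ) · 1/42      ≡⟨ Pr-kernel ψ _ ⟨
      Pr (kernel ψ) (λ _ → e (ψ u))                   ≡⟨ kernel-const ψ (e (ψ u)) ⟩
      (if e (ψ u) then 1ℚ else 0ℚ)                     ∎
      where open ≡-Reasoning

    kernel-image : ∀ ψ s (e : ℕ → Bool) →
      Pr (kernel ψ) (λ φ → e (φ (ι s))) ≡ count (λ h → e (h s)) (extensions ψ) · 1/42
    kernel-image ψ s e = trans (Pr-kernel ψ _)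
      (cong (_· 1/42) (count-cong _ (λ h → cong e (merge-image ψ h s)) (extensions ψ)))

    unblocking-colour : Fin 7 → ℕ → ℕ
    unblocking-colour s c = proj₁ (blockedAt-forced P P! s c)

    kernel-hit : ∀ ψ s {c} → c ∈ P s → ψ x′ ≢ unblocking-colour s c →
      1/21 ≤ Pr (kernel ψ) (coloured (ι s) c)
    kernel-hit ψ s {c} c∈ ψx′≢ = begin
      1/21                                        ≡⟨⟩
      2 · 1/42
        ≤⟨ ·-monoˡ-≤ (ℚ.nonNegative⁻¹ 1/42) (colourings-hit P P! (ψ x′) s c∈ unblocked) ⟩
      count (coloured s c) (extensions ψ) · 1/42  ≡⟨ kernel-image ψ s (λ x → does (x ℕ.≟ c)) ⟨
      Pr (kernel ψ) (coloured (ι s) c)           ∎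
      where
      open ℚ.≤-Reasoning
      unblocked : ¬ BlockedAt P P! (ψ x′) s c
      unblocked = ψx′≢ ∘ proj₂ (blockedAt-forced P P! s c) (ψ x′)

    kernel-avoid : ∀ ψ s d → 1/14 ≤ Pr (kernel ψ) (not ∘ coloured (ι s) d)
    kernel-avoid ψ s d = begin
      1/14                                             ≡⟨⟩
      3 · 1/42
        ≤⟨ ·-monoˡ-≤ (ℚ.nonNegative⁻¹ 1/42) (colourings-avoid P P! (ψ x′) s d) ⟩
      count (not ∘ coloured s d) (extensions ψ) · 1/42  ≡⟨ kernel-image ψ s (λ x → not (does (x ℕ.≟ d))) ⟨
      Pr (kernel ψ) (not ∘ coloured (ι s) d)           ∎
      where open ℚ.≤-Reasoning

    module _ {d : Dist (n G)} (d≥0 : NonNegWeights d) where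

      total-extension : total (d >>= kernel) ≡ total d
      total-extension = begin
        total (d >>= kernel)             ≡⟨ total≡Pr (d >>= kernel) ⟩
        Pr (d >>= kernel) (λ _ → true)   ≡⟨ Pr-bind-≡ kernel (λ ψ → kernel-const ψ true) d ⟩
        Pr d (λ _ → true)                ≡⟨ total≡Pr d ⟨
        total d                          ∎
        where open ≡-Reasoning

      PrEq-extension-outside : ∀ {u} → ¬ (∃ λ s → ι s ≡ u) → ∀ c → PrEq (d >>= kernel) u c ≡ PrEq d u c
      PrEq-extension-outside {u} ¬image c = begin
        PrEq (d >>= kernel) u c           ≡⟨ PrEq≡Pr (d >>= kernel) u c ⟩
        Pr (d >>= kernel) (coloured u c)
          ≡⟨ Pr-bind-≡ kernel (λ ψ → kernel-outside ψ ¬image (λ x → does (x ℕ.≟ c))) d ⟩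
        Pr d (coloured u c)               ≡⟨ PrEq≡Pr d u c ⟨
        PrEq d u c                        ∎
        where open ≡-Reasoning

      PrNeq-extension-outside : ∀ {u} → ¬ (∃ λ s → ι s ≡ u) → ∀ c → PrNeq (d >>= kernel) u c ≡ PrNeq d u c
      PrNeq-extension-outside {u} ¬image c = begin
        PrNeq (d >>= kernel) u c                ≡⟨ PrNeq≡Pr (d >>= kernel) u c ⟩
        Pr (d >>= kernel) (not ∘ coloured u c)
          ≡⟨ Pr-bind-≡ kernel (λ ψ → kernel-outside ψ ¬image (λ x → not (does (x ℕ.≟ c)))) d ⟩
        Pr d (not ∘ coloured u c)               ≡⟨ PrNeq≡Pr d u c ⟨
        PrNeq d u c                             ∎
        where open ≡-Reasoning

      PrEq-extension-image : ∀ s {c} → c ∈ P s →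
        1/21 * PrNeq d x′ (unblocking-colour s c) ≤ PrEq (d >>= kernel) (ι s) c
      PrEq-extension-image s {c} c∈ = begin
        1/21 * PrNeq d x′ (unblocking-colour s c)                ≡⟨ cong (1/21 *_) (PrNeq≡Pr d x′ _) ⟩
        1/21 * Pr d (not ∘ coloured x′ (unblocking-colour s c))
          ≤⟨ Pr-bind-≥ kernel (λ ψ → Pr-nonneg (kernel-nonneg ψ) _) hit d≥0 ⟩
        Pr (d >>= kernel) (coloured (ι s) c)                     ≡⟨ PrEq≡Pr (d >>= kernel) (ι s) c ⟨
        PrEq (d >>= kernel) (ι s) c                              ∎
        where
        open ℚ.≤-Reasoning
        hit : ∀ ψ → not (coloured x′ (unblocking-colour s c) ψ) ≡ true →
          1/21 ≤ Pr (kernel ψ) (coloured (ι s) c)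
        hit ψ unblocked = kernel-hit ψ s c∈ (not-coloured⇒≢ ψ unblocked)

      PrNeq-extension-image : ∀ s c → 1/14 * total d ≤ PrNeq (d >>= kernel) (ι s) c
      PrNeq-extension-image s c = begin
        1/14 * total d                               ≡⟨ cong (1/14 *_) (total≡Pr d) ⟩
        1/14 * Pr d (λ _ → true)
          ≤⟨ Pr-bind-≥ kernel (λ ψ → Pr-nonneg (kernel-nonneg ψ) _) (λ ψ _ → kernel-avoid ψ s c) d≥0 ⟩
        Pr (d >>= kernel) (not ∘ coloured (ι s) c)  ≡⟨ PrNeq≡Pr (d >>= kernel) (ι s) c ⟨
        PrNeq (d >>= kernel) (ι s) c                 ∎
        where open ℚ.≤-Reasoning

    extension : ∀ {ε α} → α ≤ 1/14 → ε ≤ 1/21 * α → Has3Dist G L (∁ S) ε α → Has3Dist G L full ε α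
    extension {ε} {α} α≤1/14 ε≤α/21 (d , (d-ok , d-total) , d-eq , d-neq) =
      d >>= kernel , (AllD-bind kernel kernel-ok d-ok , trans (total-extension d≥0) d-total) , eq , neq
      where
      d≥0 : NonNegWeights d
      d≥0 = AllD-map proj₁ d-ok

      kernel-ok : ∀ {p ψ} → 0ℚ ≤ p × IsLColoring G L (∁ S) ψ →
        AllD (λ q φ → 0ℚ ≤ p * q × IsLColoring G L full φ) (kernel ψ)
      kernel-ok {p} {ψ} (p≥0 , ψ-col) =
        AllD-uniform 1/42 (All.map⁺ (All.map (λ h-good → p/42≥0 , merge-colouring ψ-col h-good)
                                             (colourings-good P P! (ψ x′))))
        where
        p/42≥0 : 0ℚ ≤ p * 1/42
        p/42≥0 =
          subst (_≤ p * 1/42) (ℚ.*-zeroʳ p) (ℚ.*-monoˡ-≤-nonNeg p {{nonNegative p≥0}} (ℚ.nonNegative⁻¹ 1/42))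

      eq : ∀ u c → u ∈ₛ full → c ∈L L at u → ε ≤ PrEq (d >>= kernel) u c
      eq u c _ c∈ with image? u
      ... | yes (s , refl) = begin
        ε                                          ≤⟨ ε≤α/21 ⟩
        1/21 * α                                   ≤⟨ ℚ.*-monoˡ-≤-nonNeg 1/21 (d-neq x′ _ x′∈∁S) ⟩
        1/21 * PrNeq d x′ (unblocking-colour s c)  ≤⟨ PrEq-extension-image d≥0 s c∈ ⟩
        PrEq (d >>= kernel) (ι s) c                ∎
        where open ℚ.≤-Reasoning
      ... | no ¬image =
        subst (ε ≤_) (sym (PrEq-extension-outside d≥0 ¬image c)) (d-eq u c (∉image⇒∈∁S ¬image) c∈)

      neq : ∀ u c → u ∈ₛ full → α ≤ PrNeq (d >>= kernel) u c
      neq u c _ with image? u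
      ... | yes (s , refl) = begin
        α                              ≤⟨ α≤1/14 ⟩
        1/14                           ≡⟨ ℚ.*-identityʳ 1/14 ⟨
        1/14 * 1ℚ                      ≡⟨ cong (1/14 *_) d-total ⟨
        1/14 * total d                 ≤⟨ PrNeq-extension-image d≥0 s c ⟩
        PrNeq (d >>= kernel) (ι s) c   ∎
        where open ℚ.≤-Reasoning
      ... | no ¬image =
        subst (α ≤_) (sym (PrNeq-extension-outside d≥0 ¬image c)) (d-neq u c (∉image⇒∈∁S ¬image))

lemma3p6 : (α ε : ℚ) → 0ℚ < α → α ≤ 1/14 → 0ℚ < ε → ε ≤ 1/21 * α →
    (G : Graph) (H : H7-in G) → (∀ s → deg G (emb H s) ≡ 3) →
    Reducible3 G H ε α
lemma3p6 α ε _ α≤1/14 _ ε≤α/21 G H deg≡3 =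
  S , (ι 𝐚 , ι∈S 𝐚) , (λ _ → ∈S⇒image) , (λ L → extension L α≤1/14 ε≤α/21)
  where open Copy G H deg≡3
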